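{- Let $k\ge 2$ and $n\ge1$, and consider the chips $0,1,\dots,k^n-1$ starting at the root of the infinite rooted directed $k$-ary tree. Let $c$ be a chip with $n$-digit $k$-ary expansion $a_1a_2\dots a_n$, and for $i\in\{0,\dots,k-1\}$ let $f_i$ be the number of indices $j$ with $a_j=i$. Then, as $w$ ranges over $S_n$, the number of distinct positions (vertices on layer $n+1$) that chip $c$ occupies in the stable configuration $\mathcal{C}_{k,n,w}$ is $\frac{n!}{f_0!\,f_1!\cdots f_{k-1}!}$.
   Context: The infinite rooted directed $k$-ary tree has a root on layer $1$; every vertex has $k$ children, ordered left to right, on the next layer. A vertex with at least $k$ chips may fire by choosing $k$ of its labeled chips and sending the $j$th smallest to its $j$th leftmost child. Chips $0,\dots,k^n-1$ are written in $n$-digit $k$-ary expansion $a_1\dots a_n$ (leading zeros allowed, $a_1$ most significant). For $w=w_1\dots w_n\in S_n$, the strategy $F_w$ fires, for each $i\in[n]$, each vertex $v$ on layer $i$ so that all chips on $v$ whose $w_i$th most significant digit equals $j$ go to the $(j+1)$th leftmost child of $v$ ($j=0,\dots,k-1$). The resulting stable configuration, in which each vertex of layer $n+1$ holds exactly one chip, is denoted $\mathcal{C}_{k,n,w}$. -}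

module Defs where

open import Data.Nat using (ℕ; zero; suc; _+_; _*_; _∸_; _^_; _!; NonZero)
open import Data.Nat.Properties using (m^n≢0; m*n≢0; _!≢0)
open import Data.Nat.DivMod using (_/_; _%_; m%n<n)
open import Data.Fin using (Fin; toℕ; fromℕ<; _≟_)
open import Data.List using (List; []; _∷_; _∷ʳ_; foldl; filter; length; map)
open import Data.Fin.Permutation using (Permutation′; _⟨$⟩ʳ_)

-- Vertices of the infinite rooted k-ary tree: the path of child choices from
-- the root (child index 0 = leftmost).  A vertex given by a path of length m
-- lies on layer m+1.
Vertex : ℕ → Set
Vertex k = List (Fin k)

-- The j-th most significant digit (j = 0,...,n-1, i.e. a_{j+1}) of the
-- n-digit k-ary expansion of chip c.
digit : (k n c : ℕ) .{{_ : NonZero k}} → Fin n → Fin k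
digit k n c j =
  fromℕ< (m%n<n ((_/_ c (k ^ (n ∸ suc (toℕ j))) {{m^n≢0 k (n ∸ suc (toℕ j))}})) k)

-- Position of chip c after the strategy F_w fires layers 1..n:
-- on layer i+1 (i : Fin n), the chip moves to the child indexed by its
-- w_{i+1}-th most significant digit.
finalPosition : (k n c : ℕ) .{{_ : NonZero k}} → Permutation′ n → Vertex k
finalPosition k n c w =
  foldl (λ v i → v ∷ʳ digit k n c (w ⟨$⟩ʳ i)) [] (Data.List.allFin n)
  where import Data.List

digitCount : (k n c : ℕ) .{{_ : NonZero k}} → Fin k → ℕ
digitCount k n c i = length (filter (λ j → digit k n c j ≟ i) (Data.List.allFin n))
  where import Data.List

factProd : List ℕ → ℕ
factProd [] = 1
factProd (x ∷ xs) = x ! * factProd xs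

factProd≢0 : (xs : List ℕ) → NonZero (factProd xs)
factProd≢0 [] = _
factProd≢0 (x ∷ xs) = m*n≢0 (x !) (factProd xs) {{x !≢0}} {{factProd≢0 xs}}

multinomial : ℕ → List ℕ → ℕ
multinomial n fs = _/_ (n !) (factProd fs) {{factProd≢0 fs}}

module Submission where

-- Under F_w the chip descends along the word a_{w_1} … a_{w_n} of its own digits, so its
-- reachable positions are exactly the rearrangements of its digit word: the words whose
-- letter multiplicities are f = (f_0, …, f_{k-1}).  Listing these words by their first
-- letter i, the words starting with i are the rearrangements for f − e_i, and
-- ∏_j f_j! = f_i · ∏_j (f − e_i)_j!; hence, by induction on m = Σ f, the number A(f) of
-- rearrangements satisfies A(f) · ∏_j f_j! = Σ_i f_i · (m − 1)! = m!.

open import Defs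
open import Data.Nat using (ℕ; zero; suc; _+_; _*_; _∸_; _^_; _!; _≤_; _<_; z≤n; s≤s; NonZero)
open import Data.Nat.Properties
  using (+-suc; *-assoc; *-comm; *-zeroʳ; *-identityˡ; +-cancelˡ-≡; suc-injective; m+n≡0⇒m≡0; m+n≡0⇒n≡0;
         m+[n∸m]≡n; m+n∸m≡n; *-commutativeSemigroup; +-*-semiring)
open import Data.Nat.DivMod using (_/_; m*n/n≡m)
open import Algebra.Properties.CommutativeSemigroup *-commutativeSemigroup using (x∙yz≈y∙xz)
open import Algebra.Properties.Semiring.Sum +-*-semiring
  using (sum; sum-syntax; sum-cong-≗; sum-replicate-zero; sum-permute; sum-remove; *-distribˡ-sum; *-distribʳ-sum)
open import Data.Bool using (if_then_else_)
open import Data.Fin using (Fin; zero; suc; punchIn)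
open import Data.Fin.Properties using (_≟_)
open import Data.Fin.Permutation as Perm using (Permutation′; _⟨$⟩ʳ_)
open import Data.Vec.Functional using (Vector)
open import Data.List using (List; []; _∷_; _++_; _∷ʳ_; foldl; filter; length; map; concat; tabulate; allFin)
open import Data.List.Properties
  using (length-++; length-map; length-tabulate; map-tabulate; tabulate-cong; ++-assoc; ++-identityʳ;
         ∷-injectiveˡ; ∷-injectiveʳ)
open import Data.List.Membership.Propositional using (_∈_)
open import Data.List.Membership.Propositional.Properties using (∈-concat⁺; ∈-concat⁻; ∈-map⁺; ∈-map⁻; ∈-tabulate⁻)
open import Data.List.Relation.Binary.Disjoint.Propositional using (Disjoint)
open import Data.List.Relation.Unary.Any using (here; there)
import Data.List.Relation.Unary.Any.Properties as Any
open import Data.List.Relation.Unary.All using ([])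
import Data.List.Relation.Unary.All.Properties as All
import Data.List.Relation.Unary.AllPairs.Properties as AllPairs
open import Data.List.Relation.Unary.Unique.Propositional using (Unique; []; _∷_)
import Data.List.Relation.Unary.Unique.Propositional.Properties as Unique
open import Data.Product using (Σ; ∃; _×_; _,_; uncurry)
open import Function using (_∘_; id)
open import Function.Bundles using (_⇔_; mk⇔; Equivalence)
open import Relation.Nullary using (does; yes; no; contradiction)
open import Relation.Binary.PropositionalEquality
  using (_≡_; _≢_; _≗_; refl; sym; trans; cong; cong₂; subst; module ≡-Reasoning)

private
  variable
    k m n : ℕ

δ : Fin k → Fin k → ℕ
δ i j = if does (i ≟ j) then 1 else 0

δ-diag : (i : Fin k) → δ i i ≡ 1
δ-diag i with i ≟ i
... | yes _   = refl
... | no i≢i = contradiction refl i≢i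

decrement : Vector ℕ k → Fin k → Vector ℕ k
decrement f i j = f j ∸ δ i j

decrement-split : (f : Vector ℕ k) (i : Fin k) → 1 ≤ f i → ∀ j → δ i j + decrement f i j ≡ f j
decrement-split f i 1≤fi j = m+[n∸m]≡n (δ≤f j)
  where
  δ≤f : ∀ j → δ i j ≤ f j
  δ≤f j with i ≟ j
  ... | yes refl = 1≤fi
  ... | no _     = z≤n

sum-δ+ : (i : Fin k) (g : Vector ℕ k) → sum (λ j → δ i j + g j) ≡ suc (sum g)
sum-δ+ zero    g = refl
sum-δ+ (suc i) g = trans (cong (g zero +_) (sum-δ+ i (g ∘ suc))) (+-suc (g zero) (sum (g ∘ suc)))

sum-decrement : (f : Vector ℕ k) (i : Fin k) → 1 ≤ f i → sum f ≡ suc (sum (decrement f i))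
sum-decrement f i 1≤fi = trans (sum-cong-≗ (sym ∘ decrement-split f i 1≤fi)) (sum-δ+ i (decrement f i))

sum≡0⇒≗0 : (f : Vector ℕ k) → sum f ≡ 0 → ∀ j → f j ≡ 0
sum≡0⇒≗0 f Σf≡0 zero    = m+n≡0⇒m≡0 (f zero) Σf≡0
sum≡0⇒≗0 f Σf≡0 (suc j) = sum≡0⇒≗0 (f ∘ suc) (m+n≡0⇒n≡0 (f zero) Σf≡0) j

factProdᵛ : Vector ℕ k → ℕ
factProdᵛ f = factProd (tabulate f)

factProdᵛ-δ+ : (i : Fin k) (g : Vector ℕ k) → factProdᵛ (λ j → δ i j + g j) ≡ suc (g i) * factProdᵛ g
factProdᵛ-δ+ zero    g = *-assoc (suc (g zero)) (g zero !) (factProdᵛ (g ∘ suc))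
factProdᵛ-δ+ (suc i) g = trans (cong (g zero ! *_) (factProdᵛ-δ+ i (g ∘ suc)))
                               (x∙yz≈y∙xz (g zero !) (suc (g (suc i))) (factProdᵛ (g ∘ suc)))

factProdᵛ-decrement : (f : Vector ℕ k) (i : Fin k) → 1 ≤ f i →
                      factProdᵛ f ≡ f i * factProdᵛ (decrement f i)
factProdᵛ-decrement f i 1≤fi = begin
  factProdᵛ f                   ≡⟨ cong factProd (tabulate-cong (sym ∘ split)) ⟩
  factProdᵛ (λ j → δ i j + g j) ≡⟨ factProdᵛ-δ+ i g ⟩
  suc (g i) * factProdᵛ g       ≡⟨ cong (λ d → (d + g i) * factProdᵛ g) (sym (δ-diag i)) ⟩
  (δ i i + g i) * factProdᵛ g   ≡⟨ cong (_* factProdᵛ g) (split i) ⟩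
  f i * factProdᵛ g             ∎
  where
  open ≡-Reasoning
  g : Vector ℕ _
  g = decrement f i
  split : ∀ j → δ i j + g j ≡ f j
  split = decrement-split f i 1≤fi

sum≡0⇒factProdᵛ≡1 : (f : Vector ℕ k) → sum f ≡ 0 → factProdᵛ f ≡ 1
sum≡0⇒factProdᵛ≡1 {zero}  f Σf≡0 = refl
sum≡0⇒factProdᵛ≡1 {suc k} f Σf≡0 rewrite m+n≡0⇒m≡0 (f zero) Σf≡0 =
  trans (*-identityˡ _) (sum≡0⇒factProdᵛ≡1 (f ∘ suc) (m+n≡0⇒n≡0 (f zero) Σf≡0))

occurrences : List (Fin k) → Vector ℕ k
occurrences v j = length (filter (_≟ j) v)

occurrences-∷ : (x : Fin k) (v : List (Fin k)) → ∀ j → occurrences (x ∷ v) j ≡ δ x j + occurrences v j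
occurrences-∷ x v j with x ≟ j
... | yes _ = refl
... | no _  = refl

occurrences-∷-self : (x : Fin k) (v : List (Fin k)) → occurrences (x ∷ v) x ≡ suc (occurrences v x)
occurrences-∷-self x v = trans (occurrences-∷ x v x) (cong (_+ occurrences v x) (δ-diag x))

occurrences≡suc⇒∈ : {x : Fin k} {r : ℕ} (v : List (Fin k)) → occurrences v x ≡ suc r → x ∈ v
occurrences≡suc⇒∈ {x = x} (y ∷ v) eq with y ≟ x
... | yes refl = here refl
... | no _     = there (occurrences≡suc⇒∈ v eq)

occurrences-map : {A : Set} (g : A → Fin k) (xs : List A) →
                  ∀ j → length (filter (λ x → g x ≟ j) xs) ≡ occurrences (map g xs) j
occurrences-map g []       j = refl
occurrences-map g (x ∷ xs) j with g x ≟ j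
... | yes _ = cong suc (occurrences-map g xs j)
... | no _  = occurrences-map g xs j

sum-occurrences : (v : List (Fin k)) → sum (occurrences v) ≡ length v
sum-occurrences {k} []    = sum-replicate-zero k
sum-occurrences (x ∷ v) = begin
  sum (occurrences (x ∷ v))           ≡⟨ sum-cong-≗ (occurrences-∷ x v) ⟩
  sum (λ j → δ x j + occurrences v j) ≡⟨ sum-δ+ x (occurrences v) ⟩
  suc (sum (occurrences v))           ≡⟨ cong suc (sum-occurrences v) ⟩
  suc (length v)                      ∎
  where open ≡-Reasoning

occurrences-tabulate : (h : Fin n → Fin k) → ∀ j → occurrences (tabulate h) j ≡ ∑[ i < n ] δ (h i) j
occurrences-tabulate {zero}  h j = refl
occurrences-tabulate {suc n} h j = trans (occurrences-∷ (h zero) (tabulate (h ∘ suc)) j)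
                                         (cong (δ (h zero) j +_) (occurrences-tabulate (h ∘ suc) j))

occurrences-permute : (h : Fin n → Fin k) (σ : Permutation′ n) →
                      occurrences (tabulate (h ∘ (σ ⟨$⟩ʳ_))) ≗ occurrences (tabulate h)
occurrences-permute h σ j = begin
  occurrences (tabulate (h ∘ (σ ⟨$⟩ʳ_))) j ≡⟨ occurrences-tabulate (h ∘ (σ ⟨$⟩ʳ_)) j ⟩
  ∑[ i < _ ] δ (h (σ ⟨$⟩ʳ i)) j            ≡⟨ sum-permute (λ i → δ (h i) j) σ ⟨
  ∑[ i < _ ] δ (h i) j                     ≡⟨ occurrences-tabulate h j ⟨
  occurrences (tabulate h) j               ∎
  where open ≡-Reasoning

occurrences-punchIn : (h : Fin (suc n) → Fin k) (p : Fin (suc n)) →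
                      ∀ j → occurrences (tabulate h) j ≡ δ (h p) j + occurrences (tabulate (h ∘ punchIn p)) j
occurrences-punchIn h p j = begin
  occurrences (tabulate h) j                           ≡⟨ occurrences-tabulate h j ⟩
  ∑[ i < _ ] δ (h i) j                                 ≡⟨ sum-remove {i = p} (λ i → δ (h i) j) ⟩
  δ (h p) j + ∑[ i < _ ] δ (h (punchIn p i)) j         ≡⟨ cong (δ (h p) j +_) (occurrences-tabulate h′ j) ⟨
  δ (h p) j + occurrences (tabulate h′) j              ∎
  where
  open ≡-Reasoning
  h′ : Fin _ → Fin _
  h′ = h ∘ punchIn p

same-occurrences⇒permutation : (h : Fin n → Fin k) (v : List (Fin k)) → length v ≡ n →
                               occurrences v ≗ occurrences (tabulate h) →
                               ∃ λ (σ : Permutation′ n) → tabulate (h ∘ (σ ⟨$⟩ʳ_)) ≡ v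
same-occurrences⇒permutation {zero}  h []      _     _      = Perm.id , refl
same-occurrences⇒permutation {suc n} h (x ∷ v) |v|≡n occ-eq
  with p , refl ← ∈-tabulate⁻ {f = h}
                    (occurrences≡suc⇒∈ (tabulate h) (trans (sym (occ-eq x)) (occurrences-∷-self x v))) =
  let σ , σ-works = same-occurrences⇒permutation (h ∘ punchIn p) v (suc-injective |v|≡n) occ-eq′ in
  Perm.insert zero p σ , cong (h p ∷_) (trans (tabulate-cong (cong h ∘ Perm.insert-punchIn zero p σ)) σ-works)
  where
  occ-eq′ : occurrences v ≗ occurrences (tabulate (h ∘ punchIn p))
  occ-eq′ j = +-cancelˡ-≡ (δ (h p) j) (occurrences v j) (occurrences (tabulate (h ∘ punchIn p)) j)
    (trans (sym (occurrences-∷ (h p) v j)) (trans (occ-eq j) (occurrences-punchIn h p j)))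

-- The guard is needed because decrement f i = f when f i = 0 (truncated subtraction).
prependIfPositive : ℕ → Fin k → List (List (Fin k)) → List (List (Fin k))
prependIfPositive zero    i ws = []
prependIfPositive (suc _) i ws = map (i ∷_) ws

∈-prependIfPositive⁻ : ∀ c {i : Fin k} {ws v} → v ∈ prependIfPositive c i ws →
                       1 ≤ c × ∃ λ w → v ≡ i ∷ w × w ∈ ws
∈-prependIfPositive⁻ (suc _) v∈ with w , w∈ , refl ← ∈-map⁻ _ v∈ = s≤s z≤n , w , refl , w∈

∈-prependIfPositive⁺ : ∀ {c} {i : Fin k} {ws w} → 1 ≤ c → w ∈ ws → i ∷ w ∈ prependIfPositive c i ws
∈-prependIfPositive⁺ (s≤s z≤n) w∈ = ∈-map⁺ _ w∈

prependIfPositive-unique : ∀ c {i : Fin k} {ws} → Unique ws → Unique (prependIfPositive c i ws)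
prependIfPositive-unique zero    _     = []
prependIfPositive-unique (suc _) ws-un = Unique.map⁺ ∷-injectiveʳ ws-un

-- The length m is meant to equal sum f; it is passed separately so that the recursion is structural.
arrangements : ℕ → Vector ℕ k → List (List (Fin k))
arrangements zero    f = [] ∷ []
arrangements (suc m) f = concat (tabulate λ i → prependIfPositive (f i) i (arrangements m (decrement f i)))

∈-arrangements⁻ : (f : Vector ℕ k) → sum f ≡ m → ∀ {v} → v ∈ arrangements m f →
                  length v ≡ m × occurrences v ≗ f
∈-arrangements⁻ {m = zero}  f Σf≡0   (here refl) = refl , sym ∘ sum≡0⇒≗0 f Σf≡0
∈-arrangements⁻ {m = suc m} f Σf≡1+m v∈
  with i , v∈ᵢ ← Any.tabulate⁻ (∈-concat⁻ _ v∈)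
  with 1≤fi , w , refl , w∈ ← ∈-prependIfPositive⁻ (f i) v∈ᵢ =
  let Σg≡m          = suc-injective (trans (sym (sum-decrement f i 1≤fi)) Σf≡1+m)
      |w|≡m , occ-w = ∈-arrangements⁻ (decrement f i) Σg≡m w∈
  in cong suc |w|≡m ,
     λ j → trans (occurrences-∷ i w j) (trans (cong (δ i j +_) (occ-w j)) (decrement-split f i 1≤fi j))

∈-arrangements⁺ : (f : Vector ℕ k) (v : List (Fin k)) → length v ≡ m → occurrences v ≗ f →
                  v ∈ arrangements m f
∈-arrangements⁺ {m = zero}  f []      _       _      = here refl
∈-arrangements⁺ {m = suc m} f (i ∷ w) |v|≡1+m occ-eq =
  ∈-concat⁺ (Any.tabulate⁺ i (∈-prependIfPositive⁺ 1≤fi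
    (∈-arrangements⁺ (decrement f i) w (suc-injective |v|≡1+m) occ-w)))
  where
  1≤fi : 1 ≤ f i
  1≤fi = subst (1 ≤_) (trans (sym (occurrences-∷-self i w)) (occ-eq i)) (s≤s z≤n)
  occ-w : occurrences w ≗ decrement f i
  occ-w j = sym (trans (cong (_∸ δ i j) (trans (sym (occ-eq j)) (occurrences-∷ i w j)))
                       (m+n∸m≡n (δ i j) (occurrences w j)))

arrangements-unique : (m : ℕ) (f : Vector ℕ k) → Unique (arrangements m f)
arrangements-unique zero    f = [] ∷ []
arrangements-unique (suc m) f =
  Unique.concat⁺ (All.tabulate⁺ λ i → prependIfPositive-unique (f i) (arrangements-unique m (decrement f i)))
                 (AllPairs.tabulate⁺ disjoint)
  where
  branch : Fin _ → List (List (Fin _))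
  branch i = prependIfPositive (f i) i (arrangements m (decrement f i))
  disjoint : ∀ {i j} → i ≢ j → Disjoint (branch i) (branch j)
  disjoint {i} {j} i≢j (v∈ᵢ , v∈ⱼ)
    with _ , _ , refl , _ ← ∈-prependIfPositive⁻ (f i) v∈ᵢ
    with _ , _ , i∷w≡j∷w′ , _ ← ∈-prependIfPositive⁻ (f j) v∈ⱼ = i≢j (∷-injectiveˡ i∷w≡j∷w′)

length-concat-tabulate : {A : Set} (G : Fin n → List A) → length (concat (tabulate G)) ≡ ∑[ i < n ] length (G i)
length-concat-tabulate {zero}  G = refl
length-concat-tabulate {suc n} G =
  trans (length-++ (G zero)) (cong (length (G zero) +_) (length-concat-tabulate (G ∘ suc)))

length-arrangements : (m : ℕ) (f : Vector ℕ k) → sum f ≡ m → length (arrangements m f) * factProdᵛ f ≡ m !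
length-arrangements zero    f Σf≡0   = trans (*-identityˡ _) (sum≡0⇒factProdᵛ≡1 f Σf≡0)
length-arrangements (suc m) f Σf≡1+m = begin
  length (concat (tabulate branch)) * factProdᵛ f ≡⟨ cong (_* factProdᵛ f) (length-concat-tabulate branch) ⟩
  (∑[ i < _ ] length (branch i)) * factProdᵛ f    ≡⟨ *-distribʳ-sum (factProdᵛ f) (length ∘ branch) ⟩
  ∑[ i < _ ] (length (branch i) * factProdᵛ f)    ≡⟨ sum-cong-≗ (λ i → length-branch i (f i) refl) ⟩
  ∑[ i < _ ] (m ! * f i)                          ≡⟨ *-distribˡ-sum (m !) f ⟨
  m ! * sum f                                     ≡⟨ cong (m ! *_) Σf≡1+m ⟩
  m ! * suc m                                     ≡⟨ *-comm (m !) (suc m) ⟩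
  suc m !                                         ∎
  where
  open ≡-Reasoning
  branch : Fin _ → List (List (Fin _))
  branch i = prependIfPositive (f i) i (arrangements m (decrement f i))
  length-branch : ∀ i c → f i ≡ c →
                  length (prependIfPositive c i (arrangements m (decrement f i))) * factProdᵛ f ≡ m ! * c
  length-branch i zero    _      = sym (*-zeroʳ (m !))
  length-branch i (suc r) fi≡1+r = begin
    length (map (i ∷_) A) * factProdᵛ f ≡⟨ cong₂ _*_ (length-map (i ∷_) A) (factProdᵛ-decrement f i 1≤fi) ⟩
    length A * (f i * factProdᵛ g)      ≡⟨ x∙yz≈y∙xz (length A) (f i) (factProdᵛ g) ⟩
    f i * (length A * factProdᵛ g)      ≡⟨ cong₂ _*_ fi≡1+r (length-arrangements m g Σg≡m) ⟩
    suc r * m !                         ≡⟨ *-comm (suc r) (m !) ⟩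
    m ! * suc r                         ∎
    where
    g : Vector ℕ _
    g = decrement f i
    A : List (List (Fin _))
    A = arrangements m g
    1≤fi : 1 ≤ f i
    1≤fi = subst (1 ≤_) (sym fi≡1+r) (s≤s z≤n)
    Σg≡m : sum g ≡ m
    Σg≡m = suc-injective (trans (sym (sum-decrement f i 1≤fi)) Σf≡1+m)

*factProdᵛ≡!⇒≡multinomial : (n : ℕ) (f : Vector ℕ k) {L : ℕ} →
                             L * factProdᵛ f ≡ n ! → L ≡ multinomial n (map f (allFin k))
*factProdᵛ≡!⇒≡multinomial n f {L} eq rewrite map-tabulate id f =
  trans (sym (m*n/n≡m L (factProdᵛ f) {{factProd≢0 (tabulate f)}}))
        (cong (λ x → _/_ x (factProdᵛ f) {{factProd≢0 (tabulate f)}}) eq)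

foldl-∷ʳ-map : {A B : Set} (g : A → B) (acc : List B) (xs : List A) →
               foldl (λ v x → v ∷ʳ g x) acc xs ≡ acc ++ map g xs
foldl-∷ʳ-map g acc []       = sym (++-identityʳ acc)
foldl-∷ʳ-map g acc (x ∷ xs) = trans (foldl-∷ʳ-map g (acc ∷ʳ g x) xs) (++-assoc acc (g x ∷ []) (map g xs))

finalPosition≡tabulate : (k n c : ℕ) .{{_ : NonZero k}} (w : Permutation′ n) →
                         finalPosition k n c w ≡ tabulate (digit k n c ∘ (w ⟨$⟩ʳ_))
finalPosition≡tabulate k n c w =
  trans (foldl-∷ʳ-map (digit k n c ∘ (w ⟨$⟩ʳ_)) [] (allFin n)) (map-tabulate id (digit k n c ∘ (w ⟨$⟩ʳ_)))

digitCount≗occurrences : (k n c : ℕ) .{{_ : NonZero k}} → digitCount k n c ≗ occurrences (tabulate (digit k n c))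
digitCount≗occurrences k n c j =
  trans (occurrences-map (digit k n c) (allFin n) j)
        (cong (λ v → occurrences v j) (map-tabulate id (digit k n c)))

finalPosition⇔rearrangement : (k n c : ℕ) .{{_ : NonZero k}} (v : List (Fin k)) →
  (∃ λ (w : Permutation′ n) → finalPosition k n c w ≡ v) ⇔ (length v ≡ n × occurrences v ≗ digitCount k n c)
finalPosition⇔rearrangement k n c v = mk⇔ reached⇒rearrangement rearrangement⇒reached
  where
  h : Fin n → Fin k
  h = digit k n c
  reached⇒rearrangement : ∃ (λ w → finalPosition k n c w ≡ v) → length v ≡ n × occurrences v ≗ digitCount k n c
  reached⇒rearrangement (w , refl) rewrite finalPosition≡tabulate k n c w =
    length-tabulate (h ∘ (w ⟨$⟩ʳ_)) ,
    λ j → trans (occurrences-permute h w j) (sym (digitCount≗occurrences k n c j))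
  rearrangement⇒reached : length v ≡ n × occurrences v ≗ digitCount k n c → ∃ (λ w → finalPosition k n c w ≡ v)
  rearrangement⇒reached (|v|≡n , occ-eq) =
    let σ , σ-works = same-occurrences⇒permutation h v |v|≡n
                        (λ j → trans (occ-eq j) (digitCount≗occurrences k n c j))
    in σ , trans (finalPosition≡tabulate k n c σ) σ-works

proposition3p4 : (k n : ℕ) .{{_ : NonZero k}} → 2 ≤ k → 1 ≤ n →
    (c : ℕ) → c < k ^ n →
    Σ (List (Vertex k)) (λ L →
      Unique L ×
      ((v : Vertex k) → (v ∈ L ⇔ ∃ (λ (w : Permutation′ n) → finalPosition k n c w ≡ v))) ×
      (length L ≡ multinomial n (map (digitCount k n c) (allFin k))))
proposition3p4 k n _ _ c _ =
  arrangements n f ,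
  arrangements-unique n f ,
  (λ v → mk⇔ (Equivalence.from (finalPosition⇔rearrangement k n c v) ∘ ∈-arrangements⁻ f Σf≡n)
             (uncurry (∈-arrangements⁺ f v) ∘ Equivalence.to (finalPosition⇔rearrangement k n c v))) ,
  *factProdᵛ≡!⇒≡multinomial n f (length-arrangements n f Σf≡n)
  where
  f : Vector ℕ k
  f = digitCount k n c
  Σf≡n : sum f ≡ n
  Σf≡n = trans (sum-cong-≗ (digitCount≗occurrences k n c))
               (trans (sum-occurrences (tabulate (digit k n c))) (length-tabulate (digit k n c)))
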